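{- Let $\mathcal X=(\Omega,S)$ be a scheme whose thin residue extension $\mathcal X_{(T)}$ is separable. Then $\mathcal X$ is separable, and $\mathcal X$ is schurian if and only if $\mathcal X_{(T)}$ is schurian.
   Context: A coherent configuration is a pair $(\Omega,S)$ with $\Omega$ finite and $S$ a partition of $\Omega\times\Omega$ (basic relations) such that $1_\Omega$ is a union of elements of $S$, $S$ is closed under transposition $r\mapsto r^*$, and for $u,v,w\in S$ the number $c_{uv}^w=|\alpha u\cap\gamma v^*|$ (with $\alpha r=\{\beta:(\alpha,\beta)\in r\}$) is independent of $(\alpha,\gamma)\in w$; it is a scheme if $1_\Omega\in S$. For $u,v\in S$, $uv$ is the set of basic relations contained in the relational product $u\cdot v$. $T'\subseteq S$ is closed if $uv^*\subseteq T'$ for all $u,v\in T'$. The thin residue $T$ of a scheme is the intersection of all closed subsets of $S$ containing $\bigcup_{u\in S}uu^*$; the union of the relations in $T$ is an equivalence relation on $\Omega$ whose set of classes is denoted $\Omega/T$. The thin residue extension is $\mathcal X_{(T)}=(\Omega,S_{(T)})$ where $S_{(T)}$ is the set of all nonempty relations $u\cap(\Delta\times\Gamma)$ with $u\in S$, $\Delta,\Gamma\in\Omega/T$; it is a coherent configuration. A coherent configuration is schurian if its basic relations are the orbits on $\Omega\times\Omega$ of some permutation group on $\Omega$. An algebraic isomorphism from $(\Omega,S)$ to $(\Omega',S')$ is a bijection $\varphi:S\to S'$ with $c_{uv}^w=c_{\varphi(u)\varphi(v)}^{\varphi(w)}$ for all $u,v,w$; a coherent configuration is separable if every algebraic isomorphism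 from it to any coherent configuration is induced by a bijection $f:\Omega\to\Omega'$ with $u^f=\varphi(u)$ for all $u\in S$. -}

module Defs where

open import Data.Nat using (ℕ; zero; suc; _+_)
open import Data.Bool using (Bool; true; false; _∧_; _∨_; if_then_else_; not)
import Data.Bool as B
open import Data.Fin using (Fin; zero; suc)
import Data.Fin as F
open import Data.Vec using (Vec; []; _∷_; tabulate; lookup)
import Data.Vec.Properties as VP
import Data.Product.Properties as PP
open import Data.List using (List; []; _∷_; map; _++_)
open import Data.Product using (Σ; _×_; _,_)
open import Function using (id; _∘_)
open import Function.Definitions using (Bijective)
open import Relation.Binary.PropositionalEquality using (_≡_)
open import Relation.Binary.Definitions using (DecidableEquality)
open import Relation.Nullary.Decidable using (⌊_⌋)

count : ∀ {n} → (Fin n → Bool) → ℕ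
count {zero}  p = 0
count {suc n} p = (if p zero then 1 else 0) + count (λ i → p (suc i))

anyF : ∀ {n} → (Fin n → Bool) → Bool
anyF {zero}  p = false
anyF {suc n} p = p zero ∨ anyF (λ i → p (suc i))

allF : ∀ {n} → (Fin n → Bool) → Bool
allF {zero}  p = true
allF {suc n} p = p zero ∧ allF (λ i → p (suc i))

allL : ∀ {A : Set} → (A → Bool) → List A → Bool
allL p []       = true
allL p (x ∷ xs) = p x ∧ allL p xs

allSubsets : ∀ m → List (Vec Bool m)
allSubsets zero    = [] ∷ []
allSubsets (suc m) = map (true ∷_) (allSubsets m) ++ map (false ∷_) (allSubsets m)

-- The basic relations S are
-- the (nonempty) colour classes  { (α,β) : col α β ≡ c }  for c in the
-- image of col; a basic relation is named by any representative pair
-- (a , b), i.e. u = the class of col a b.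

record Coloring : Set₁ where
  field
    size  : ℕ
    C     : Set
    _≟C_  : DecidableEquality C
    col   : Fin size → Fin size → C

module _ (X : Coloring) where
  open Coloring X

  isec : Fin size → Fin size → C → C → ℕ
  isec α γ u v = count (λ β → ⌊ col α β ≟C u ⌋ ∧ ⌊ col β γ ≟C v ⌋)

  record IsCoherent : Set where
    field
      -- 1_Ω is a union of basic relations
      diagUnion : ∀ α β γ → col α α ≡ col β γ → β ≡ γ
      transpose : ∀ α β γ δ → col α β ≡ col γ δ → col β α ≡ col δ γ
      -- c_{uv}^w independent of (α,γ) ∈ w  (u = class of (a,b), v = class of (c,d))
      regular   : ∀ α γ α' γ' → col α γ ≡ col α' γ' → ∀ a b c d →
                  isec α γ (col a b) (col c d) ≡ isec α' γ' (col a b) (col c d)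

  -- scheme: additionally 1_Ω ∈ S
  IsScheme : Set
  IsScheme = IsCoherent × (∀ α β → col α α ≡ col β β)

  -- schurian: the basic relations are the orbits on Ω × Ω of a permutation group
  Schurian : Set₁
  Schurian =
    Σ ((Fin size → Fin size) → Set) λ G →
      G id
    × (∀ f g → G f → G g → G (f ∘ g))
    × (∀ f → G f → Σ (Fin size → Fin size) λ g →
         G g × (∀ x → g (f x) ≡ x) × (∀ x → f (g x) ≡ x))
    × (∀ α β α' β' →
         (col α β ≡ col α' β' →
            Σ (Fin size → Fin size) λ g → G g × g α ≡ α' × g β ≡ β')
       × (Σ (Fin size → Fin size) (λ g → G g × g α ≡ α' × g β ≡ β') →
            col α β ≡ col α' β'))

-- algebraic isomorphism from X to X' given by φ on colours
-- (φ restricted to S is a bijection S → S' preserving intersection numbers)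
record IsAlgIso (X X' : Coloring) (φ : Coloring.C X → Coloring.C X') : Set where
  open Coloring X
  open Coloring X' renaming (size to size'; C to C'; col to col')
  field
    into   : ∀ a b → Σ (Fin size') λ a' → Σ (Fin size') λ b' → col' a' b' ≡ φ (col a b)
    inj    : ∀ a b c d → φ (col a b) ≡ φ (col c d) → col a b ≡ col c d
    onto   : ∀ a' b' → Σ (Fin size) λ a → Σ (Fin size) λ b → φ (col a b) ≡ col' a' b'
    preserve : ∀ α γ α' γ' → col' α' γ' ≡ φ (col α γ) → ∀ a b c d →
               isec X' α' γ' (φ (col a b)) (φ (col c d)) ≡ isec X α γ (col a b) (col c d)

Separable : Coloring → Set₁
Separable X =
  (X' : Coloring) → IsCoherent X' →
  (φ : Coloring.C X → Coloring.C X') → IsAlgIso X X' φ →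
  Σ (Fin (Coloring.size X) → Fin (Coloring.size X')) λ f →
    Bijective _≡_ _≡_ f ×
    -- u^f = φ(u) for every basic relation u (= class of (a,b))
    (∀ a b α β →
       (Coloring.col X α β ≡ Coloring.col X a b →
          Coloring.col X' (f α) (f β) ≡ φ (Coloring.col X a b))
     × (Coloring.col X' (f α) (f β) ≡ φ (Coloring.col X a b) →
          Coloring.col X α β ≡ Coloring.col X a b))

finColoring : ∀ {n m} → (Fin n → Fin n → Fin m) → Coloring
finColoring {n} {m} col = record { size = n ; C = Fin m ; _≟C_ = F._≟_ ; col = col }

module ThinResidue {n m : ℕ} (col : Fin n → Fin n → Fin m) where

  -- w ∈ u v*  : w is contained in the relational product u · v*
  inProdStar : Fin m → Fin m → Fin m → Bool
  inProdStar u v w =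
    anyF λ α → anyF λ γ → ⌊ col α γ F.≟ w ⌋ ∧
      anyF λ β → ⌊ col α β F.≟ u ⌋ ∧ ⌊ col γ β F.≟ v ⌋

  closed : Vec Bool m → Bool
  closed T' = allF λ u → allF λ v → allF λ w →
    not (lookup T' u ∧ lookup T' v ∧ inProdStar u v w) ∨ lookup T' w

  containsUUs : Vec Bool m → Bool
  containsUUs T' = allF λ u → allF λ w → not (inProdStar u u w) ∨ lookup T' w

  inT : Fin m → Bool
  inT w = allL (λ T' → not (closed T' ∧ containsUUs T') ∨ lookup T' w) (allSubsets m)

  -- the class of α in Ω/T, as a subset of Ω
  classOf : Fin n → Vec Bool n
  classOf α = tabulate (λ β → inT (col α β))

  -- thin residue extension X_(T): colour of (α,β) is (u, Δ, Γ) with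
  -- (α,β) ∈ u ∩ (Δ × Γ)
  thinExt : Coloring
  thinExt = record
    { size = n
    ; C    = Fin m × Vec Bool n × Vec Bool n
    ; _≟C_ = PP.≡-dec F._≟_ (PP.≡-dec (VP.≡-dec B._≟_) (VP.≡-dec B._≟_))
    ; col  = λ α β → col α β , classOf α , classOf β
    }

module Submission where

-- Write x ~ y when col x y lies in the thin residue T.  After Boolean
-- bookkeeping for the finite quantifiers and counts of Defs, we show that
-- (1) refining a coherent configuration by a compatible labelling of its
-- points keeps it coherent, with explicitly known intersection numbers;
-- (2) ~ is a normal equivalence relation, and the class of β is recorded
-- by its label {col α₀ γ : γ ~ β} relative to a base point α₀.
-- Given an algebraic isomorphism φ : X → X', equal intersection numbers
-- carry triangles between X and X'; this transports T and the labels to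
-- X', giving a refinement X'' of X' algebraically isomorphic to X_(T).
-- Separability of X_(T) then yields a bijection realizing φ (so X is
-- separable) that moves a chosen base point into a chosen T-class.  For
-- φ = id this makes Aut X transitive on Ω/T, so Aut X witnesses that X is
-- schurian whenever X_(T) is; conversely, the elements of a group for X
-- that fix every T-class form a group for X_(T).

open import Defs
open import Data.Nat using (ℕ; zero; suc; _+_)
open import Data.Nat.Properties using (1+n≢0)
open import Data.Bool using (Bool; true; false; _∧_; _∨_; not; if_then_else_)
import Data.Bool as Bool
open import Data.Bool.Properties using (∧-conicalˡ; ∧-conicalʳ; ⇔→≡; ¬-not)
open import Data.Fin using (Fin; zero; suc)
import Data.Fin as Fin
open import Data.Vec using (Vec; []; _∷_; tabulate; lookup)
import Data.Vec.Properties as Vec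
import Data.Product.Properties as Product
open import Data.List using (List; []; _∷_; map; _++_)
open import Data.Product using (Σ; _×_; _,_; proj₁; proj₂)
open import Data.Empty using (⊥; ⊥-elim)
open import Function using (id; _∘_)
open import Function.Bundles using (_⇔_; mk⇔)
open import Function.Definitions using (Bijective)
open import Relation.Binary.PropositionalEquality
open import Relation.Binary.Definitions using (DecidableEquality)
open import Relation.Nullary using (Dec; yes; no)
open import Relation.Nullary.Decidable using (⌊_⌋)

∧-intro : ∀ {a b} → a ≡ true → b ≡ true → a ∧ b ≡ true
∧-intro refl refl = refl

⇒-elim : ∀ {a b} → not a ∨ b ≡ true → a ≡ true → b ≡ true
⇒-elim {true} p refl = p

⇒-intro : ∀ {a b} → (a ≡ true → b ≡ true) → not a ∨ b ≡ true
⇒-intro {true}  f = f refl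
⇒-intro {false} f = refl

bool-ext : ∀ {a b} → (a ≡ true → b ≡ true) → (b ≡ true → a ≡ true) → a ≡ b
bool-ext f g = ⇔→≡ (mk⇔ f g)

vec-ext : ∀ {k} {u v : Vec Bool k} → (∀ i → lookup u i ≡ true → lookup v i ≡ true) →
          (∀ i → lookup v i ≡ true → lookup u i ≡ true) → u ≡ v
vec-ext {u = u} {v} f g = begin
  u                  ≡⟨ Vec.tabulate∘lookup u ⟨
  tabulate (lookup u) ≡⟨ Vec.tabulate-cong (λ i → bool-ext (f i) (g i)) ⟩
  tabulate (lookup v) ≡⟨ Vec.tabulate∘lookup v ⟩
  v                  ∎
  where open ≡-Reasoning

dec-sound : ∀ {ℓ} {P : Set ℓ} (d : Dec P) → ⌊ d ⌋ ≡ true → P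
dec-sound (yes p) _  = p
dec-sound (no _)  ()

dec-true : ∀ {ℓ} {P : Set ℓ} (d : Dec P) → P → ⌊ d ⌋ ≡ true
dec-true (yes _) _ = refl
dec-true (no ¬p) p = ⊥-elim (¬p p)

dec-agree : ∀ {P Q : Set} (p? : Dec P) (q? : Dec Q) → (P → Q) → (Q → P) → ⌊ p? ⌋ ≡ ⌊ q? ⌋
dec-agree p? q? f g =
  bool-ext (λ h → dec-true q? (f (dec-sound p? h))) (λ h → dec-true p? (g (dec-sound q? h)))

anyF-intro : ∀ {n} (p : Fin n → Bool) i → p i ≡ true → anyF p ≡ true
anyF-intro p zero    h = cong (_∨ anyF (p ∘ suc)) h
anyF-intro p (suc i) h with p zero
... | true  = refl
... | false = anyF-intro (p ∘ suc) i h

anyF-elim : ∀ {n} (p : Fin n → Bool) → anyF p ≡ true → Σ (Fin n) λ i → p i ≡ true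
anyF-elim {suc n} p h with p zero in eq
... | true  = zero , eq
... | false = let (i , pi) = anyF-elim (p ∘ suc) h in suc i , pi

anyF-cong : ∀ {n} {p q : Fin n → Bool} → (∀ i → p i ≡ q i) → anyF p ≡ anyF q
anyF-cong {zero}  h = refl
anyF-cong {suc n} h = cong₂ _∨_ (h zero) (anyF-cong (h ∘ suc))

allF-intro : ∀ {n} (p : Fin n → Bool) → (∀ i → p i ≡ true) → allF p ≡ true
allF-intro {zero}  p h = refl
allF-intro {suc n} p h = ∧-intro (h zero) (allF-intro (p ∘ suc) (h ∘ suc))

allF-elim : ∀ {n} (p : Fin n → Bool) → allF p ≡ true → ∀ i → p i ≡ true
allF-elim p h zero    = ∧-conicalˡ _ _ h
allF-elim p h (suc i) = allF-elim (p ∘ suc) (∧-conicalʳ (p zero) _ h) i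

allL-intro : ∀ {A : Set} (p : A → Bool) (xs : List A) → (∀ x → p x ≡ true) → allL p xs ≡ true
allL-intro p []       h = refl
allL-intro p (x ∷ xs) h = ∧-intro (h x) (allL-intro p xs h)

allSubsets-elim : ∀ m (p : Vec Bool m → Bool) → allL p (allSubsets m) ≡ true → ∀ v → p v ≡ true
allSubsets-elim zero    p h []      = ∧-conicalˡ _ _ h
allSubsets-elim (suc m) p h (b ∷ v) = allSubsets-elim m (p ∘ (b ∷_)) (half b) v
  where
  allL-++ : ∀ {A : Set} (q : A → Bool) xs ys → allL q (xs ++ ys) ≡ true →
            allL q xs ≡ true × allL q ys ≡ true
  allL-++ q []       ys h = refl , h
  allL-++ q (x ∷ xs) ys h =
    let (l , r) = allL-++ q xs ys (∧-conicalʳ (q x) _ h) in ∧-intro (∧-conicalˡ _ _ h) l , r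

  allL-map : ∀ {A B : Set} (q : B → Bool) (f : A → B) xs → allL q (map f xs) ≡ true → allL (q ∘ f) xs ≡ true
  allL-map q f []       h = refl
  allL-map q f (x ∷ xs) h = ∧-intro (∧-conicalˡ _ _ h) (allL-map q f xs (∧-conicalʳ (q (f x)) _ h))

  halves : allL p (map (true ∷_) (allSubsets m)) ≡ true × allL p (map (false ∷_) (allSubsets m)) ≡ true
  halves = allL-++ p (map (true ∷_) (allSubsets m)) (map (false ∷_) (allSubsets m)) h

  half : ∀ b → allL (p ∘ (b ∷_)) (allSubsets m) ≡ true
  half true  = allL-map p (true ∷_)  (allSubsets m) (proj₁ halves)
  half false = allL-map p (false ∷_) (allSubsets m) (proj₂ halves)

count-cong : ∀ {n} {p q : Fin n → Bool} → (∀ i → p i ≡ q i) → count p ≡ count q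
count-cong {zero}  h = refl
count-cong {suc n} h = cong₂ _+_ (cong (λ b → if b then 1 else 0) (h zero)) (count-cong (h ∘ suc))

count-none : ∀ {n} (p : Fin n → Bool) → (∀ i → p i ≡ false) → count p ≡ 0
count-none {zero}  p h = refl
count-none {suc n} p h rewrite h zero = count-none (p ∘ suc) (h ∘ suc)

count-nonzero : ∀ {n} (p : Fin n → Bool) i → p i ≡ true → count p ≡ 0 → ⊥
count-nonzero p zero h e rewrite h = 1+n≢0 e
count-nonzero p (suc i) h e with p zero
... | true  = 1+n≢0 e
... | false = count-nonzero (p ∘ suc) i h e

count-witness : ∀ {n} (p : Fin n → Bool) → (count p ≡ 0 → ⊥) → Σ (Fin n) λ i → p i ≡ true
count-witness {zero}  p h = ⊥-elim (h refl)
count-witness {suc n} p h with p zero in eq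
... | true  = zero , eq
... | false = let (i , pi) = count-witness (p ∘ suc) h in suc i , pi

witness-transfer : ∀ {n k} (p : Fin n → Bool) (q : Fin k → Bool) → count p ≡ count q →
  ∀ i → p i ≡ true → Σ (Fin k) λ j → q j ≡ true
witness-transfer p q e i h = count-witness q (λ q0 → count-nonzero p i h (trans e q0))

count-restrict : ∀ {N} (P Q : Fin N → Bool) (k : Bool) →
  (∀ i → P i ≡ true → Q i ≡ true × k ≡ true) →
  (∀ i → Q i ≡ true → k ≡ true → P i ≡ true) →
  count P ≡ (if k then count Q else 0)
count-restrict P Q true  to from = count-cong λ i → bool-ext (proj₁ ∘ to i) (λ q → from i q refl)
count-restrict P Q false to from = count-none P λ i → ¬-not λ Pi → false≢true (proj₂ (to i Pi))
  where
  false≢true : false ≡ true → ⊥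
  false≢true ()

,₃-injective : ∀ {A B C : Set} {a a' : A} {b b' : B} {c c' : C} →
  (a , b , c) ≡ (a' , b' , c') → a ≡ a' × b ≡ b' × c ≡ c'
,₃-injective refl = refl , refl , refl

cong-,₃ : ∀ {A B C : Set} {a a' : A} {b b' : B} {c c' : C} →
  a ≡ a' → b ≡ b' → c ≡ c' → (a , b , c) ≡ (a' , b' , c')
cong-,₃ refl refl refl = refl

-- The thin residue
-- extension is the refinement by the map α ↦ (T-class of α).
refine : (X : Coloring) {L : Set} → DecidableEquality L → (Fin (Coloring.size X) → L) → Coloring
refine X {L} _≟L_ ℓ = record
  { size = size
  ; C    = C × L × L
  ; _≟C_ = Product.≡-dec _≟C_ (Product.≡-dec _≟L_ _≟L_)
  ; col  = λ α β → col α β , ℓ α , ℓ β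
  }
  where open Coloring X

module Refinement (X : Coloring) {L : Set} (_≟L_ : DecidableEquality L)
                  (ℓ : Fin (Coloring.size X) → L) where
  open Coloring X

  Compatible : Set
  Compatible = ∀ α β a b → col α β ≡ col a b → ℓ α ≡ ℓ a → ℓ β ≡ ℓ b

  labels-fit : L → L → L → L → L → L → Bool
  labels-fit ℓα L₁ L₂ L₃ ℓγ L₄ = ⌊ ℓα ≟L L₁ ⌋ ∧ ⌊ L₂ ≟L L₃ ⌋ ∧ ⌊ ℓγ ≟L L₄ ⌋

  isec-refine : ∀ α γ u L₁ L₂ v L₃ L₄ → (∀ β → col α β ≡ u → ℓ α ≡ L₁ → ℓ β ≡ L₂) →
    isec (refine X _≟L_ ℓ) α γ (u , L₁ , L₂) (v , L₃ , L₄) ≡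
    (if labels-fit (ℓ α) L₁ L₂ L₃ (ℓ γ) L₄ then isec X α γ u v else 0)
  isec-refine α γ u L₁ L₂ v L₃ L₄ determined = count-restrict refined unrefined fit to from
    where
    _≟⁺_ : DecidableEquality (C × L × L)
    _≟⁺_ = Coloring._≟C_ (refine X _≟L_ ℓ)
    col⁺ : Fin size → Fin size → C × L × L
    col⁺ = Coloring.col (refine X _≟L_ ℓ)
    refined unrefined : Fin size → Bool
    refined   β = ⌊ col⁺ α β ≟⁺ (u , L₁ , L₂) ⌋ ∧ ⌊ col⁺ β γ ≟⁺ (v , L₃ , L₄) ⌋
    unrefined β = ⌊ col α β ≟C u ⌋ ∧ ⌊ col β γ ≟C v ⌋
    fit : Bool
    fit = labels-fit (ℓ α) L₁ L₂ L₃ (ℓ γ) L₄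

    to : ∀ β → refined β ≡ true → unrefined β ≡ true × fit ≡ true
    to β h =
      let (c₁ , l₁ , l₂) = ,₃-injective (dec-sound (_ ≟⁺ _) (∧-conicalˡ _ _ h))
          (c₂ , l₃ , l₄) = ,₃-injective (dec-sound (_ ≟⁺ _) (∧-conicalʳ _ _ h))
      in ∧-intro (dec-true (_ ≟C _) c₁) (dec-true (_ ≟C _) c₂) ,
         ∧-intro (dec-true (_ ≟L _) l₁)
                 (∧-intro (dec-true (_ ≟L _) (trans (sym l₂) l₃)) (dec-true (_ ≟L _) l₄))

    from : ∀ β → unrefined β ≡ true → fit ≡ true → refined β ≡ true
    from β q k =
      let cu = dec-sound (_ ≟C _) (∧-conicalˡ _ _ q)
          cv = dec-sound (_ ≟C _) (∧-conicalʳ _ _ q)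
          lα = dec-sound (_ ≟L _) (∧-conicalˡ _ _ k)
          k′ = ∧-conicalʳ ⌊ ℓ α ≟L L₁ ⌋ _ k
          lβ = dec-sound (_ ≟L _) (∧-conicalˡ _ _ k′)
          lγ = dec-sound (_ ≟L _) (∧-conicalʳ _ _ k′)
          ℓβ = determined β cu lα
      in ∧-intro (dec-true (_ ≟⁺ _) (cong-,₃ cu lα ℓβ))
                 (dec-true (_ ≟⁺ _) (cong-,₃ cv (trans ℓβ lβ) lγ))

  isec-refine-compatible : Compatible → ∀ x z a b c d →
    isec (refine X _≟L_ ℓ) x z (col a b , ℓ a , ℓ b) (col c d , ℓ c , ℓ d) ≡
    (if labels-fit (ℓ x) (ℓ a) (ℓ b) (ℓ c) (ℓ z) (ℓ d) then isec X x z (col a b) (col c d) else 0)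
  isec-refine-compatible compatible x z a b c d =
    isec-refine x z (col a b) (ℓ a) (ℓ b) (col c d) (ℓ c) (ℓ d) (λ β e₁ e₂ → compatible x β a b e₁ e₂)

  refine-coherent : IsCoherent X → Compatible → IsCoherent (refine X _≟L_ ℓ)
  refine-coherent coh compatible = record
    { diagUnion = λ α β γ e → IsCoherent.diagUnion coh α β γ (proj₁ (,₃-injective e))
    ; transpose = λ α β γ δ e →
        let (c , lα , lβ) = ,₃-injective e in cong-,₃ (IsCoherent.transpose coh α β γ δ c) lβ lα
    ; regular   = regular
    }
    where
    open ≡-Reasoning
    regular : ∀ α γ α' γ' → (col α γ , ℓ α , ℓ γ) ≡ (col α' γ' , ℓ α' , ℓ γ') → ∀ a b c d →
      isec (refine X _≟L_ ℓ) α γ (col a b , ℓ a , ℓ b) (col c d , ℓ c , ℓ d) ≡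
      isec (refine X _≟L_ ℓ) α' γ' (col a b , ℓ a , ℓ b) (col c d , ℓ c , ℓ d)
    regular α γ α' γ' e a b c d =
      let (e-col , e-α , e-γ) = ,₃-injective e
      in begin
        isec (refine X _≟L_ ℓ) α γ _ _
          ≡⟨ isec-refine-compatible compatible α γ a b c d ⟩
        (if labels-fit (ℓ α) (ℓ a) (ℓ b) (ℓ c) (ℓ γ) (ℓ d) then isec X α γ (col a b) (col c d) else 0)
          ≡⟨ cong₂ (λ fit k → if fit then k else 0)
                   (cong₂ (λ lα lγ → labels-fit lα (ℓ a) (ℓ b) (ℓ c) lγ (ℓ d)) e-α e-γ)
                   (IsCoherent.regular coh α γ α' γ' e-col a b c d) ⟩
        (if labels-fit (ℓ α') (ℓ a) (ℓ b) (ℓ c) (ℓ γ') (ℓ d) then isec X α' γ' (col a b) (col c d) else 0)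
          ≡⟨ isec-refine-compatible compatible α' γ' a b c d ⟨
        isec (refine X _≟L_ ℓ) α' γ' _ _
          ∎

module ThinResidueOfScheme {n m : ℕ} (col : Fin n → Fin n → Fin m)
                           (sch : IsScheme (finColoring col)) where
  open ThinResidue col
  open IsCoherent (proj₁ sch)

  complete-triangle : ∀ α γ α' γ' β → col α γ ≡ col α' γ' →
    Σ (Fin n) λ β' → col α' β' ≡ col α β × col β' γ' ≡ col β γ
  complete-triangle α γ α' γ' β e =
    let (β' , h) = witness-transfer _ _ (regular α γ α' γ' e α β β γ) β
                     (∧-intro (dec-true (col α β Fin.≟ col α β) refl) (dec-true (col β γ Fin.≟ col β γ) refl))
    in β' , dec-sound (_ Fin.≟ _) (∧-conicalˡ _ _ h) , dec-sound (_ Fin.≟ _) (∧-conicalʳ _ _ h)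

  out-neighbour : ∀ x c d → Σ (Fin n) λ y → col x y ≡ col c d
  out-neighbour x c d = let (y , e , _) = complete-triangle c c x x d (proj₂ sch c x) in y , e

  inProdStar-intro : ∀ {u v w} α γ β → col α γ ≡ w → col α β ≡ u → col γ β ≡ v →
    inProdStar u v w ≡ true
  inProdStar-intro α γ β e₁ e₂ e₃ =
    anyF-intro _ α (anyF-intro _ γ (∧-intro (dec-true (_ Fin.≟ _) e₁)
      (anyF-intro _ β (∧-intro (dec-true (_ Fin.≟ _) e₂) (dec-true (_ Fin.≟ _) e₃)))))

  inProdStar-elim : ∀ {u v w} → inProdStar u v w ≡ true →
    Σ (Fin n) λ α → Σ (Fin n) λ γ → Σ (Fin n) λ β → col α γ ≡ w × col α β ≡ u × col γ β ≡ v
  inProdStar-elim h =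
    let (α , h₁) = anyF-elim _ h
        (γ , h₂) = anyF-elim _ h₁
        (β , h₃) = anyF-elim _ (∧-conicalʳ _ _ h₂)
    in α , γ , β , dec-sound (_ Fin.≟ _) (∧-conicalˡ _ _ h₂) ,
       dec-sound (_ Fin.≟ _) (∧-conicalˡ _ _ h₃) , dec-sound (_ Fin.≟ _) (∧-conicalʳ _ _ h₃)

  Admissible : Vec Bool m → Set
  Admissible T' = closed T' ∧ containsUUs T' ≡ true

  admissible-intro : ∀ T' →
    (∀ u v w → lookup T' u ≡ true → lookup T' v ≡ true → inProdStar u v w ≡ true → lookup T' w ≡ true) →
    (∀ u w → inProdStar u u w ≡ true → lookup T' w ≡ true) → Admissible T'
  admissible-intro T' isClosed hasUUs = ∧-intro
    (allF-intro _ λ u → allF-intro _ λ v → allF-intro _ λ w → ⇒-intro λ h →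
       isClosed u v w (∧-conicalˡ _ _ h) (∧-conicalˡ _ _ (∧-conicalʳ (lookup T' u) _ h))
                      (∧-conicalʳ _ _ (∧-conicalʳ (lookup T' u) _ h)))
    (allF-intro _ λ u → allF-intro _ λ w → ⇒-intro (hasUUs u w))

  inT-elim : ∀ {w} → inT w ≡ true → ∀ T' → Admissible T' → lookup T' w ≡ true
  inT-elim h T' adm = ⇒-elim (allSubsets-elim m _ h T') adm

  inT-intro : ∀ {w} → (∀ T' → Admissible T' → lookup T' w ≡ true) → inT w ≡ true
  inT-intro h = allL-intro _ (allSubsets m) λ T' → ⇒-intro (h T')

  module Admissible (T' : Vec Bool m) (adm : Admissible T') where
    private
      in-T' : Fin n → Fin n → Set
      in-T' x y = lookup T' (col x y) ≡ true

      isClosed : ∀ {u v w} → lookup T' u ≡ true → lookup T' v ≡ true →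
                 inProdStar u v w ≡ true → lookup T' w ≡ true
      isClosed {u} {v} {w} hu hv hp =
        ⇒-elim (allF-elim _ (allF-elim _ (allF-elim _ (∧-conicalˡ _ _ adm) u) v) w)
               (∧-intro hu (∧-intro hv hp))

    common : ∀ x y z → col x y ≡ col z y → in-T' x z
    common x y z e = ⇒-elim (allF-elim _ (allF-elim _ (∧-conicalʳ (closed T') _ adm) (col x y)) (col x z))
                            (inProdStar-intro x z y refl refl (sym e))

    symmetric : ∀ x y → in-T' x y → in-T' y x
    symmetric x y h = isClosed (common y y y refl) h (inProdStar-intro y x y refl refl refl)

    transitive : ∀ x y z → in-T' x y → in-T' y z → in-T' x z
    transitive x y z h₁ h₂ = isClosed h₁ (symmetric y z h₂) (inProdStar-intro x z y refl refl refl)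

  infix 4 _~_
  _~_ : Fin n → Fin n → Set
  x ~ y = inT (col x y) ≡ true

  ~-common : ∀ x y z → col x y ≡ col z y → x ~ z
  ~-common x y z e = inT-intro λ T' adm → Admissible.common T' adm x y z e

  ~-refl : ∀ x → x ~ x
  ~-refl x = ~-common x x x refl

  ~-sym : ∀ x y → x ~ y → y ~ x
  ~-sym x y h = inT-intro λ T' adm → Admissible.symmetric T' adm x y (inT-elim h T' adm)

  ~-trans : ∀ x y z → x ~ y → y ~ z → x ~ z
  ~-trans x y z h₁ h₂ =
    inT-intro λ T' adm → Admissible.transitive T' adm x y z (inT-elim h₁ T' adm) (inT-elim h₂ T' adm)

  -- The
  -- normalizing colours form an admissible set, so every colour of T is
  -- normalizing.
  normalizing : Fin m → Bool
  normalizing t = allF λ x → allF λ z → allF λ y → allF λ y' →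
    not (⌊ col x z Fin.≟ t ⌋ ∧ ⌊ col x y Fin.≟ col z y' ⌋) ∨ inT (col y y')

  normalizing-elim : ∀ {t} → normalizing t ≡ true →
    ∀ x z y y' → col x z ≡ t → col x y ≡ col z y' → y ~ y'
  normalizing-elim h x z y y' e₁ e₂ =
    ⇒-elim (allF-elim _ (allF-elim _ (allF-elim _ (allF-elim _ h x) z) y) y')
           (∧-intro (dec-true (_ Fin.≟ _) e₁) (dec-true (_ Fin.≟ _) e₂))

  normalizing-intro : ∀ {t} →
    (∀ x z y y' → col x z ≡ t → col x y ≡ col z y' → y ~ y') → normalizing t ≡ true
  normalizing-intro f = allF-intro _ λ x → allF-intro _ λ z → allF-intro _ λ y → allF-intro _ λ y' →
    ⇒-intro λ h → f x z y y' (dec-sound (_ Fin.≟ _) (∧-conicalˡ _ _ h))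
                             (dec-sound (_ Fin.≟ _) (∧-conicalʳ _ _ h))

  -- A colour w ∈ u v* is normalizing when u and v are: a pair (x , z) of
  -- colour w is bridged by a point p with col x p ≡ u and col z p ≡ v.
  normalizing-closed : ∀ u v w → normalizing u ≡ true → normalizing v ≡ true →
    inProdStar u v w ≡ true → normalizing w ≡ true
  normalizing-closed u v w hu hv hp = normalizing-intro λ x z y y' e₁ e₂ →
    let (α , γ , β , a₁ , a₂ , a₃) = inProdStar-elim hp
        (p , b₁ , b₂) = complete-triangle α γ x z β (trans a₁ (sym e₁))
        (q , c₁) = out-neighbour p x y
    in ~-trans y q y' (normalizing-elim hu x p y q (trans b₁ a₂) (sym c₁))
         (~-sym y' q (normalizing-elim hv z p y' q (trans (transpose p z β γ b₂) a₃)
                                                   (trans (sym e₂) (sym c₁))))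

  normalizing-uu : ∀ u w → inProdStar u u w ≡ true → normalizing w ≡ true
  normalizing-uu u w hp = normalizing-intro λ x z y y' e₁ e₂ →
    let (α , γ , β , a₁ , a₂ , a₃) = inProdStar-elim hp
        (p , b₁ , b₂) = complete-triangle α γ x z β (trans a₁ (sym e₁))
        (y″ , c₁ , c₂) = complete-triangle x p z p y
                           (trans (trans b₁ a₂) (sym (trans (transpose p z β γ b₂) a₃)))
    in ~-trans y y″ y' (~-common y p y″ (sym c₂))
                       (~-common y″ z y' (transpose z y″ z y' (trans c₁ e₂)))

  ~-normal : ∀ x z y y' → x ~ z → col x y ≡ col z y' → y ~ y'
  ~-normal x z y y' h = normalizing-elim (trans (sym (lookup-N (col x z))) (inT-elim h N N-admissible)) x z y y' refl
    where
    N : Vec Bool m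
    N = tabulate normalizing
    lookup-N : ∀ t → lookup N t ≡ normalizing t
    lookup-N = Vec.lookup∘tabulate normalizing
    N-admissible : Admissible N
    N-admissible = admissible-intro N
      (λ u v w hu hv hp → trans (lookup-N w)
         (normalizing-closed u v w (trans (sym (lookup-N u)) hu) (trans (sym (lookup-N v)) hv) hp))
      (λ u w hp → trans (lookup-N w) (normalizing-uu u w hp))

  class-≡ : ∀ x y → x ~ y → classOf x ≡ classOf y
  class-≡ x y h = Vec.tabulate-cong λ γ →
    bool-ext (~-trans y x γ (~-sym x y h)) (~-trans x y γ h)

  class-≡⁻¹ : ∀ x y → classOf x ≡ classOf y → x ~ y
  class-≡⁻¹ x y e = begin
    inT (col x y)           ≡⟨ Vec.lookup∘tabulate (λ δ → inT (col x δ)) y ⟨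
    lookup (classOf x) y    ≡⟨ cong (λ c → lookup c y) e ⟩
    lookup (classOf y) y    ≡⟨ Vec.lookup∘tabulate (λ δ → inT (col y δ)) y ⟩
    inT (col y y)           ≡⟨ ~-refl y ⟩
    true                    ∎
    where open ≡-Reasoning

  -- Labels determine ~-classes, and (unlike
  -- classes) they make sense in any algebraically isomorphic configuration.
  module BaseLabels (α₀ : Fin n) where

    coloursInto : Vec Bool n → Vec Bool m
    coloursInto Δ = tabulate λ c → anyF λ γ → lookup Δ γ ∧ ⌊ col α₀ γ Fin.≟ c ⌋

    label : Fin n → Vec Bool m
    label β = coloursInto (classOf β)

    label-≡ : ∀ x y → x ~ y → label x ≡ label y
    label-≡ x y h = cong coloursInto (class-≡ x y h)

    label-intro : ∀ β γ c → β ~ γ → col α₀ γ ≡ c → lookup (label β) c ≡ true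
    label-intro β γ c h e = trans (Vec.lookup∘tabulate _ c)
      (anyF-intro _ γ (∧-intro (trans (Vec.lookup∘tabulate _ γ) h) (dec-true (_ Fin.≟ _) e)))

    label-elim : ∀ β c → lookup (label β) c ≡ true → Σ (Fin n) λ γ → β ~ γ × col α₀ γ ≡ c
    label-elim β c h =
      let (γ , h′) = anyF-elim _ (trans (sym (Vec.lookup∘tabulate _ c)) h)
      in γ , trans (sym (Vec.lookup∘tabulate _ γ)) (∧-conicalˡ _ _ h′)
           , dec-sound (_ Fin.≟ _) (∧-conicalʳ _ _ h′)

    -- The colour col α₀ x lies in the label of x, so equal labels give a
    -- point γ ~ y with col α₀ γ ≡ col α₀ x, whence γ ~ x.
    label-≡⁻¹ : ∀ x y → label x ≡ label y → x ~ y
    label-≡⁻¹ x y e =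
      let x-in-y = subst (λ l → lookup l (col α₀ x) ≡ true) e (label-intro x x _ (~-refl x) refl)
          (γ , y~γ , e′) = label-elim y (col α₀ x) x-in-y
          γ~x = ~-common γ α₀ x (transpose α₀ γ α₀ x e′)
      in ~-trans x γ y (~-sym γ x γ~x) (~-sym y γ y~γ)

    class-≡-from-label : ∀ x y → label x ≡ label y → classOf x ≡ classOf y
    class-≡-from-label x y e = class-≡ x y (label-≡⁻¹ x y e)

-- Equal intersection numbers let triangles
-- of X be carried to X' and back; with them the image of T under φ
-- defines a normal equivalence relation ~' on the points of X'.
module Transport {n m : ℕ} (col : Fin n → Fin n → Fin m) (sch : IsScheme (finColoring col))
                 (X' : Coloring) (coh' : IsCoherent X') (φ : Fin m → Coloring.C X')
                 (iso : IsAlgIso (finColoring col) X' φ) where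
  open ThinResidue col
  open ThinResidueOfScheme col sch
  open IsCoherent (proj₁ sch) using (transpose)
  open Coloring X' using () renaming (size to n'; _≟C_ to _≟'_; col to col')
  open IsAlgIso iso

  triangle-back : ∀ a c x' z' → col' x' z' ≡ φ (col a c) → ∀ y' →
    Σ (Fin n) λ β → φ (col a β) ≡ col' x' y' × φ (col β c) ≡ col' y' z'
  triangle-back a c x' z' h y' =
    let (p , q , e₁) = onto x' y'
        (r , s , e₂) = onto y' z'
        (β , w) = witness-transfer _ _ (preserve a c x' z' h p q r s) y'
                    (∧-intro (dec-true (_ ≟' _) (sym e₁)) (dec-true (_ ≟' _) (sym e₂)))
    in β , trans (cong φ (dec-sound (_ Fin.≟ _) (∧-conicalˡ _ _ w))) e₁
         , trans (cong φ (dec-sound (_ Fin.≟ _) (∧-conicalʳ _ _ w))) e₂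

  triangle-forth : ∀ a c x' z' → col' x' z' ≡ φ (col a c) → ∀ β →
    Σ (Fin n') λ y' → col' x' y' ≡ φ (col a β) × col' y' z' ≡ φ (col β c)
  triangle-forth a c x' z' h β =
    let (y' , w) = witness-transfer _ _ (sym (preserve a c x' z' h a β β c)) β
                     (∧-intro (dec-true (col a β Fin.≟ col a β) refl) (dec-true (col β c Fin.≟ col β c) refl))
    in y' , dec-sound (_ ≟' _) (∧-conicalˡ _ _ w) , dec-sound (_ ≟' _) (∧-conicalʳ _ _ w)

  diagonal : ∀ x' a → col' x' x' ≡ φ (col a a)
  diagonal x' a =
    let (p , q , e) = onto x' x'
        (γ' , h₁ , h₂) = triangle-forth p q x' x' (sym e) q
        x'≡γ' : x' ≡ γ'
        x'≡γ' = IsCoherent.diagUnion coh' x' x' γ' (trans (sym e) (sym h₁))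
    in trans (subst (λ z → col' z x' ≡ φ (col q q)) (sym x'≡γ') h₂) (cong φ (proj₂ sch q a))

  transpose-φ : ∀ x' y' a b → col' x' y' ≡ φ (col a b) → col' y' x' ≡ φ (col b a)
  transpose-φ x' y' a b h =
    let (γ' , h₁ , h₂) = triangle-forth a a x' x' (diagonal x' a) b
    in trans (sym (IsCoherent.transpose coh' x' γ' x' y' (trans h₁ (sym h)))) h₂

  inφT : Fin n' → Fin n' → Bool
  inφT x' y' = anyF λ p → anyF λ q → inT (col p q) ∧ ⌊ φ (col p q) ≟' col' x' y' ⌋

  infix 4 _~'_
  _~'_ : Fin n' → Fin n' → Set
  x' ~' y' = inφT x' y' ≡ true

  ~'-intro : ∀ p q x' y' → p ~ q → φ (col p q) ≡ col' x' y' → x' ~' y'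
  ~'-intro p q x' y' h e = anyF-intro _ p (anyF-intro _ q (∧-intro h (dec-true (_ ≟' _) e)))

  ~'-elim : ∀ a b x' y' → x' ~' y' → φ (col a b) ≡ col' x' y' → a ~ b
  ~'-elim a b x' y' h e =
    let (p , h₁) = anyF-elim _ h
        (q , h₂) = anyF-elim _ h₁
        e₂ = dec-sound (_ ≟' _) (∧-conicalʳ _ _ h₂)
    in subst (λ c → inT c ≡ true) (inj p q a b (trans e₂ (sym e))) (∧-conicalˡ _ _ h₂)

  -- ~' inherits from ~ reflexivity, symmetry, transitivity, the u u*
  -- property and normality, each by pulling the relevant triangle back to X.
  ~'-refl : ∀ x' (a : Fin n) → x' ~' x'
  ~'-refl x' a = ~'-intro a a x' x' (~-refl a) (sym (diagonal x' a))

  ~'-sym : ∀ x' y' → x' ~' y' → y' ~' x'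
  ~'-sym x' y' h =
    let (a , c , e) = onto y' x'
    in ~'-intro a c y' x' (~-sym c a (~'-elim c a x' y' h (sym (transpose-φ y' x' a c (sym e))))) e

  ~'-trans : ∀ x' y' z' → x' ~' y' → y' ~' z' → x' ~' z'
  ~'-trans x' y' z' h₁ h₂ =
    let (a , c , e) = onto x' z'
        (β , f₁ , f₂) = triangle-back a c x' z' (sym e) y'
    in ~'-intro a c x' z' (~-trans a β c (~'-elim a β x' y' h₁ f₁) (~'-elim β c y' z' h₂ f₂)) e

  ~'-common : ∀ w x' y' → col' w x' ≡ col' w y' → x' ~' y'
  ~'-common w x' y' e =
    let (b , a , e₁) = onto w x'
        (γ , f₁ , f₂) = triangle-back b a w x' (sym e₁) y'
        bγ≡ba : col b γ ≡ col b a
        bγ≡ba = inj b γ b a (trans f₁ (trans (sym e) (sym e₁)))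
        a~γ = ~-common a b γ (transpose b a b γ (sym bγ≡ba))
    in ~'-sym y' x' (~'-intro γ a y' x' (~-sym a γ a~γ) f₂)

  ~'-normal : ∀ x z y y' → x ~' z → col' x y ≡ col' z y' → y ~' y'
  ~'-normal x z y y' h e =
    let (a , c , e₁) = onto x y'
        (b , f₁ , f₂) = triangle-back a c x y' (sym e₁) z
        (β , g₁ , g₂) = triangle-back a c x y' (sym e₁) y
    in ~'-intro β c y y' (~-normal a b β c (~'-elim a b x z h f₁) (inj a β b c (trans g₁ (trans e (sym f₂))))) g₂

  module BasePoints (α₀ : Fin n) (α₀' : Fin n') where
    open BaseLabels α₀

    reaches : Fin m → Fin n' → Bool
    reaches c γ' = anyF λ p → anyF λ q → ⌊ col p q Fin.≟ c ⌋ ∧ ⌊ φ (col p q) ≟' col' α₀' γ' ⌋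

    label' : Fin n' → Vec Bool m
    label' x' = tabulate λ c → anyF λ γ' → inφT x' γ' ∧ reaches c γ'

    label'-intro : ∀ x' γ' p q → x' ~' γ' → φ (col p q) ≡ col' α₀' γ' →
      lookup (label' x') (col p q) ≡ true
    label'-intro x' γ' p q h e = trans (Vec.lookup∘tabulate _ (col p q))
      (anyF-intro _ γ' (∧-intro h (anyF-intro _ p (anyF-intro _ q
        (∧-intro (dec-true (_ Fin.≟ _) refl) (dec-true (_ ≟' _) e))))))

    label'-elim : ∀ x' c → lookup (label' x') c ≡ true →
      Σ (Fin n') λ γ' → Σ (Fin n) λ p → Σ (Fin n) λ q →
        x' ~' γ' × col p q ≡ c × φ (col p q) ≡ col' α₀' γ'
    label'-elim x' c h =
      let (γ' , h₁) = anyF-elim _ (trans (sym (Vec.lookup∘tabulate _ c)) h)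
          (p , h₂)  = anyF-elim _ (∧-conicalʳ _ _ h₁)
          (q , h₃)  = anyF-elim _ h₂
      in γ' , p , q , ∧-conicalˡ _ _ h₁ ,
         dec-sound (_ Fin.≟ _) (∧-conicalˡ _ _ h₃) , dec-sound (_ ≟' _) (∧-conicalʳ _ _ h₃)

    label'-≡ : ∀ x y → x ~' y → label' x ≡ label' y
    label'-≡ x y h = Vec.tabulate-cong λ c → anyF-cong λ γ → cong (_∧ reaches c γ)
      (bool-ext (~'-trans y x γ (~'-sym x y h)) (~'-trans x y γ h))

    label'-≡⁻¹ : ∀ x y → label' x ≡ label' y → x ~' y
    label'-≡⁻¹ x y e =
      let (p , q , e₀) = onto α₀' x
          x-in-y = subst (λ l → lookup l (col p q) ≡ true) e
                         (label'-intro x x p q (~'-refl x α₀) e₀)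
          (γ' , p₂ , q₂ , y~γ' , e₁ , e₂) = label'-elim y (col p q) x-in-y
          γ'~x = ~'-common α₀' γ' x (trans (sym e₂) (trans (cong φ e₁) e₀))
      in ~'-sym y x (~'-trans y γ' x y~γ' γ'~x)

    label'-corresponds : ∀ a x' → φ (col α₀ a) ≡ col' α₀' x' → label' x' ≡ label a
    label'-corresponds a x' h = vec-ext there back
      where
      there : ∀ c → lookup (label' x') c ≡ true → lookup (label a) c ≡ true
      there c k =
        let (γ' , p , q , x'~γ' , e₁ , e₂) = label'-elim x' c k
            (β , f₁ , f₂) = triangle-back α₀ a α₀' x' (sym h) γ'
        in label-intro a β c (~-sym β a (~'-elim β a γ' x' (~'-sym x' γ' x'~γ') f₂))
                              (trans (inj α₀ β p q (trans f₁ (sym e₂))) e₁)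
      back : ∀ c → lookup (label a) c ≡ true → lookup (label' x') c ≡ true
      back c k =
        let (γ , a~γ , e) = label-elim a c k
            (γ' , f₁ , f₂) = triangle-forth α₀ a α₀' x' (sym h) γ
        in subst (λ d → lookup (label' x') d ≡ true) e
             (label'-intro x' γ' α₀ γ (~'-sym γ' x' (~'-intro γ a γ' x' (~-sym a γ a~γ) (sym f₂))) (sym f₁))

    label'-transport : ∀ α' β' a b → col' α' β' ≡ φ (col a b) → label' α' ≡ label a → label' β' ≡ label b
    label'-transport α' β' a b h l =
      let (x , f₁ , f₂) = triangle-back α₀ α₀ α₀' α₀' (diagonal α₀' α₀) α'
          x~a = label-≡⁻¹ x a (trans (sym (label'-corresponds x α' f₁)) l)
          (y , g₁ , g₂) = triangle-back x α₀ α' α₀' (sym f₂) β'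
          g₃ = transpose-φ β' α₀' y α₀ (sym g₂)
      in trans (label'-corresponds y β' (sym g₃))
               (label-≡ y b (~-normal x a y b x~a (inj x y a b (trans g₁ h))))

    label'-compatible : Refinement.Compatible X' (Vec.≡-dec Bool._≟_) label'
    label'-compatible α β a b e l = label'-≡ β b (~'-normal α a β b (label'-≡⁻¹ α a l) e)

    X'' : Coloring
    X'' = refine X' (Vec.≡-dec Bool._≟_) label'

    X''-coherent : IsCoherent X''
    X''-coherent = Refinement.refine-coherent X' (Vec.≡-dec Bool._≟_) label' coh' label'-compatible

    -- φ extended to the colours of the thin residue extension: T-classes
    -- are replaced by the labels of their points.
    φ'' : Coloring.C thinExt → Coloring.C X''
    φ'' (c , Δ , Γ) = φ c , coloursInto Δ , coloursInto Γ

    φ''-iso : IsAlgIso thinExt X'' φ''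
    φ''-iso = record
      { into = λ a b →
          let (x' , h₁ , h₂) = triangle-forth α₀ α₀ α₀' α₀' (diagonal α₀' α₀) a
              (y' , k₁ , k₂) = triangle-forth a α₀ x' α₀' h₂ b
          in x' , y' , cong-,₃ k₁ (label'-corresponds a x' (sym h₁))
                                  (label'-corresponds b y' (sym (transpose-φ y' α₀' b α₀ k₂)))
      ; inj = λ a b c d e →
          let (e-col , e-a , e-b) = ,₃-injective e
          in cong-,₃ (inj a b c d e-col) (class-≡-from-label a c e-a) (class-≡-from-label b d e-b)
      ; onto = λ x' y' →
          let (a , f₁ , f₂) = triangle-back α₀ α₀ α₀' α₀' (diagonal α₀' α₀) x'
              (b , g₁ , g₂) = triangle-back a α₀ x' α₀' (sym f₂) y'
          in a , b , cong-,₃ g₁ (sym (label'-corresponds a x' f₁))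
                                (sym (label'-corresponds b y' (sym (transpose-φ y' α₀' b α₀ (sym g₂)))))
      ; preserve = preserves-isec
      }
      where
      open Refinement X' (Vec.≡-dec Bool._≟_) label' using (isec-refine)
      open Refinement (finColoring col) (Vec.≡-dec Bool._≟_) classOf
        renaming (isec-refine to isec-refine-T) using ()
      _≟V_ : ∀ {k} → DecidableEquality (Vec Bool k)
      _≟V_ = Vec.≡-dec Bool._≟_

      label-test : ∀ {L} x y → L ≡ label x → ⌊ L ≟V label y ⌋ ≡ ⌊ classOf x ≟V classOf y ⌋
      label-test x y lx = dec-agree (_ ≟V _) (_ ≟V _)
        (λ e → class-≡-from-label x y (trans (sym lx) e)) (λ e → trans lx (cong coloursInto e))

      preserves-isec : ∀ α γ α' γ' → Coloring.col X'' α' γ' ≡ φ'' (Coloring.col thinExt α γ) → ∀ a b c d →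
        isec X'' α' γ' (φ'' (Coloring.col thinExt a b)) (φ'' (Coloring.col thinExt c d))
          ≡ isec thinExt α γ (Coloring.col thinExt a b) (Coloring.col thinExt c d)
      preserves-isec α γ α' γ' h a b c d =
        let (h-col , h-α , h-γ) = ,₃-injective h
            fits-agree = cong₂ _∧_ (label-test α a h-α) (cong₂ _∧_ (label-test b c refl) (label-test γ d h-γ))
        in begin
          isec X'' α' γ' _ _
            ≡⟨ isec-refine α' γ' (φ (col a b)) (label a) (label b) (φ (col c d)) (label c) (label d)
                 (λ β e₁ e₂ → label'-transport α' β a b e₁ e₂) ⟩
          _ ≡⟨ cong₂ (λ fit k → if fit then k else 0) fits-agree (IsAlgIso.preserve iso α γ α' γ' h-col a b c d) ⟩
          _ ≡⟨ isec-refine-T α γ (col a b) (classOf a) (classOf b) (col c d) (classOf c) (classOf d)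
                 (λ β e₁ e₂ → class-≡ β b (~-normal α a β b (class-≡⁻¹ α a e₂) e₁)) ⟨
          isec thinExt α γ _ _ ∎
        where open ≡-Reasoning

    -- Separability of the thin residue extension, applied to φ'', yields
    -- a bijection realizing φ which maps α₀ into the ~'-class of α₀'.
    realization : Separable thinExt →
      Σ (Fin n → Fin n') λ f → Bijective _≡_ _≡_ f
        × (∀ α β → col' (f α) (f β) ≡ φ (col α β)) × f α₀ ~' α₀'
    realization sepT =
      let (f , bijective , realizes) = sepT X'' X''-coherent φ'' φ''-iso
          image : ∀ α β → col' (f α) (f β) ≡ φ (col α β) × label' (f α) ≡ label α × label' (f β) ≡ label β
          image α β = ,₃-injective (proj₁ (realizes α β α β) refl)
          label-fα₀ : label' (f α₀) ≡ label' α₀'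
          label-fα₀ = trans (proj₁ (proj₂ (image α₀ α₀)))
                            (sym (label'-corresponds α₀ α₀' (sym (diagonal α₀' α₀))))
      in f , bijective , (λ α β → proj₁ (image α β)) , label'-≡⁻¹ (f α₀) α₀' label-fα₀

-- For any choice of base
-- points the bijection given by `realization` induces φ; a scheme without
-- points is trivially separable (then X' has no points either).
separable : ∀ {n m} (col : Fin n → Fin n → Fin m) → IsScheme (finColoring col) →
  Separable (ThinResidue.thinExt col) → Separable (finColoring col)
separable {zero} col sch sepT X' coh' φ iso =
  (λ ()) , ((λ {x} → ⊥-elim (no-point x)) , λ y → ⊥-elim (no-point (proj₁ (IsAlgIso.onto iso y y)))) , λ ()
  where
  no-point : Fin 0 → ⊥
  no-point ()
separable {suc _} col sch sepT X' coh' φ iso =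
  let (f , bijective , f-col , _) = realization sepT
  in f , bijective , λ a b α β → (λ e → trans (f-col α β) (cong φ e))
                               , (λ e → IsAlgIso.inj iso α β a b (trans (sym (f-col α β)) e))
  where
  open Transport col sch X' coh' φ iso
  open BasePoints zero (proj₁ (IsAlgIso.into iso zero zero))

preserves-colours : (X : Coloring) (S : Schurian X) → ∀ g → proj₁ S g →
  ∀ x y → Coloring.col X (g x) (g y) ≡ Coloring.col X x y
preserves-colours X (G , _ , _ , _ , orbits) g g∈G x y =
  sym (proj₂ (orbits x y (g x) (g y)) (g , g∈G , refl , refl))

Orbits : (Y : Coloring) → ((Fin (Coloring.size Y) → Fin (Coloring.size Y)) → Set) → Set
Orbits Y G = ∀ α β α' β' →
  (col' α β ≡ col' α' β' → Σ (Fin size → Fin size) λ g → G g × g α ≡ α' × g β ≡ β')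
  × (Σ (Fin size → Fin size) (λ g → G g × g α ≡ α' × g β ≡ β') → col' α β ≡ col' α' β')
  where open Coloring Y renaming (col to col')

-- A group for X_(T) is obtained from one
-- for X by keeping the elements that fix every T-class.  Conversely, if
-- H is a group for X_(T), the full automorphism group of X works: it
-- moves any α into the T-class of any α' (by separability of X_(T)),
-- after which an element of H finishes the job.
module Schurity {n m : ℕ} (col : Fin n → Fin n → Fin m) (sch : IsScheme (finColoring col)) where
  open ThinResidue col
  open ThinResidueOfScheme col sch

  X : Coloring
  X = finColoring col

  IsAut : (Fin n → Fin n) → Set
  IsAut f = Σ (Fin n → Fin n) λ g →
    (∀ x → g (f x) ≡ x) × (∀ x → f (g x) ≡ x) × (∀ x y → col (f x) (f y) ≡ col x y)

  aut-id : IsAut id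
  aut-id = id , (λ _ → refl) , (λ _ → refl) , (λ _ _ → refl)

  aut-∘ : ∀ f g → IsAut f → IsAut g → IsAut (f ∘ g)
  aut-∘ f g (f⁻¹ , f⁻¹f , ff⁻¹ , f-col) (g⁻¹ , g⁻¹g , gg⁻¹ , g-col) =
    g⁻¹ ∘ f⁻¹ , (λ x → trans (cong g⁻¹ (f⁻¹f (g x))) (g⁻¹g x))
              , (λ x → trans (cong f (gg⁻¹ (f⁻¹ x))) (ff⁻¹ x))
              , (λ x y → trans (f-col (g x) (g y)) (g-col x y))

  aut-inverse : ∀ f → IsAut f → Σ (Fin n → Fin n) λ g → IsAut g × (∀ x → g (f x) ≡ x) × (∀ x → f (g x) ≡ x)
  aut-inverse f (f⁻¹ , f⁻¹f , ff⁻¹ , f-col) =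
    f⁻¹ , (f , ff⁻¹ , f⁻¹f , λ x y → trans (sym (f-col (f⁻¹ x) (f⁻¹ y))) (cong₂ col (ff⁻¹ x) (ff⁻¹ y)))
        , f⁻¹f , ff⁻¹

  bijection-aut : ∀ f → Bijective _≡_ _≡_ f → (∀ x y → col (f x) (f y) ≡ col x y) → IsAut f
  bijection-aut f (injective , surjective) f-col =
    f⁻¹ , (λ x → injective (ff⁻¹ (f x))) , ff⁻¹ , f-col
    where
    f⁻¹ : Fin n → Fin n
    f⁻¹ y = proj₁ (surjective y)
    ff⁻¹ : ∀ y → f (f⁻¹ y) ≡ y
    ff⁻¹ y = proj₂ (surjective y) refl

  identity-iso : IsAlgIso X X id
  identity-iso = record
    { into     = λ a b → a , b , refl
    ; inj      = λ a b c d e → e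
    ; onto     = λ a b → a , b , refl
    ; preserve = λ α γ α' γ' h a b c d → sym (IsCoherent.regular (proj₁ sch) α γ α' γ' (sym h) a b c d)
    }

  -- Separability of X_(T) applied to the identity makes Aut X transitive on Ω/T.
  aut-transitive : Separable thinExt → ∀ α α' → Σ (Fin n → Fin n) λ f → IsAut f × f α ~ α'
  aut-transitive sepT α α' =
    let (f , bijective , f-col , fα~'α') = realization sepT
    in f , bijection-aut f bijective f-col , ~'-elim (f α) α' (f α) α' fα~'α' refl
    where
    open Transport col sch X (proj₁ sch) id identity-iso
    open BasePoints α α'

  schurian-from-ext : Separable thinExt → Schurian thinExt → Schurian X
  schurian-from-ext sepT H-schurian@(H , _ , _ , H-inverse , H-orbits) =
    IsAut , aut-id , aut-∘ , aut-inverse , orbits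
    where
    H-aut : ∀ h → H h → IsAut h
    H-aut h h∈H =
      let (h⁻¹ , _ , h⁻¹h , hh⁻¹) = H-inverse h h∈H
      in h⁻¹ , h⁻¹h , hh⁻¹ , λ x y → proj₁ (,₃-injective (preserves-colours thinExt H-schurian h h∈H x y))

    -- move α into the T-class of α' by Aut X, then finish inside X_(T) by H
    orbits : Orbits X IsAut
    orbits α β α' β' = to , from
      where
      to : col α β ≡ col α' β' → Σ (Fin n → Fin n) λ g → IsAut g × g α ≡ α' × g β ≡ β'
      to e =
        let (f , f-aut , fα~α') = aut-transitive sepT α α'
            fαfβ≡α'β' = trans (proj₂ (proj₂ (proj₂ f-aut)) α β) e
            fβ~β' = ~-normal (f α) α' (f β) β' fα~α' fαfβ≡α'β'
            (h , h∈H , hfα , hfβ) = proj₁ (H-orbits (f α) (f β) α' β')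
              (cong-,₃ fαfβ≡α'β' (class-≡ (f α) α' fα~α') (class-≡ (f β) β' fβ~β'))
        in h ∘ f , aut-∘ h f (H-aut h h∈H) f-aut , hfα , hfβ
      from : (Σ (Fin n → Fin n) λ g → IsAut g × g α ≡ α' × g β ≡ β') → col α β ≡ col α' β'
      from (g , (_ , _ , _ , g-col) , refl , refl) = sym (g-col α β)

  schurian-to-ext : Schurian X → Schurian thinExt
  schurian-to-ext G-schurian@(G , G-id , G-∘ , G-inverse , G-orbits) =
    H , (G-id , ~-refl) , H-∘ , H-inverse , orbits
    where
    H : (Fin n → Fin n) → Set
    H f = G f × (∀ x → x ~ f x)

    g-col : ∀ g → G g → ∀ x y → col (g x) (g y) ≡ col x y
    g-col = preserves-colours X G-schurian

    H-∘ : ∀ f g → H f → H g → H (f ∘ g)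
    H-∘ f g (f∈G , f~) (g∈G , g~) =
      G-∘ f g f∈G g∈G , λ x → ~-trans x (g x) (f (g x)) (g~ x) (f~ (g x))

    H-inverse : ∀ f → H f → Σ (Fin n → Fin n) λ g → H g × (∀ x → g (f x) ≡ x) × (∀ x → f (g x) ≡ x)
    H-inverse f (f∈G , f~) =
      let (g , g∈G , gf , fg) = G-inverse f f∈G
      in g , (g∈G , λ x → ~-sym (g x) x (subst (g x ~_) (fg x) (f~ (g x)))) , gf , fg

    -- an element of G mapping α into its T-class fixes every T-class, by normality
    orbits : Orbits thinExt H
    orbits α β α' β' = to , from
      where
      to : Coloring.col thinExt α β ≡ Coloring.col thinExt α' β' →
           Σ (Fin n → Fin n) λ g → H g × g α ≡ α' × g β ≡ β'
      to e =
        let (e-col , e-α , _) = ,₃-injective e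
            (g , g∈G , gα , gβ) = proj₁ (G-orbits α β α' β') e-col
            α~gα = subst (α ~_) (sym gα) (class-≡⁻¹ α α' e-α)
        in g , (g∈G , λ x → ~-normal α (g α) x (g x) α~gα (sym (g-col g g∈G α x))) , gα , gβ
      from : (Σ (Fin n → Fin n) λ g → H g × g α ≡ α' × g β ≡ β') →
             Coloring.col thinExt α β ≡ Coloring.col thinExt α' β'
      from (g , (g∈G , g~) , refl , refl) =
        cong-,₃ (sym (g-col g g∈G α β)) (class-≡ α (g α) (g~ α)) (class-≡ β (g β) (g~ β))

theorem3p3 : (n m : ℕ) (col : Fin n → Fin n → Fin m) →
    IsScheme (finColoring col) →
    Separable (ThinResidue.thinExt col) →
    Separable (finColoring col) × (Schurian (finColoring col) ⇔ Schurian (ThinResidue.thinExt col))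
theorem3p3 n m col sch sepT =
  separable col sch sepT , mk⇔ schurian-to-ext (schurian-from-ext sepT)
  where open Schurity col sch
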